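{- Let $K\subset\mathbb R^d$ be a pointed rational polyhedral cone with non-empty interior, let $B$ be its Hilbert basis, and let $\bar B=B\cup\{0\}$. Let $\{F_1,\dots,F_M\}$ ($M\ge1$) be an antichain of faces of $K$, and for each $i$ let $\mathbf b^*_{F_i}=\sum_{\mathbf b\in B\cap F_i}\mathbf b$. Define $$A=\{2\mathbf b:\mathbf b\in B\}\cup\{2\mathbf b^*_{F_i}+\mathbf b:\ 1\le i\le M,\ \mathbf b\in\bar B\}.$$ Then (i) $\mathrm{cone}(A)=K$; (ii) the saturation of the semigroup $Q(A)$ generated by $A$ (the set of points of $\mathrm{cone}(A)$ lying in the lattice generated by $A$) is $K\cap\mathbb Z^d$; (iii) the minimal almost saturated faces of $K$ for $Q(A)$ are exactly $F_1,\dots,F_M$.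
   Context: The Hilbert basis $B$ of $K$ is the unique minimal finite subset of $K\cap\mathbb Z^d$ generating $K\cap\mathbb Z^d$ as a semigroup. An antichain of faces is a set of faces of $K$ no one of which is contained in another. $Q(A)=\{\sum_{\mathbf a\in A}\lambda_{\mathbf a}\mathbf a:\lambda_{\mathbf a}\in\mathbb N\}$. With $Q_{\rm sat}=K\cap\mathbb Z^d$, a point $\mathbf a\in Q(A)$ is a saturation point of $Q(A)$ if $\mathbf a+Q_{\rm sat}\subset Q(A)$. A face $F$ of $K$ is almost saturated (for $Q(A)$) if it contains a saturation point of $Q(A)$; it is a minimal almost saturated face if it is almost saturated and no face $G\subsetneq F$ of $K$ is almost saturated.
   Formalization: The cone K, cone(A) and the faces of K are taken as sets of points of ℚ^d rather than ℝ^d, and pointedness and non-empty interior are tested on rational points. -}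

module Defs where

open import Data.Nat using (ℕ)
open import Data.Integer using (ℤ; +_)
open import Data.Rational using (ℚ; 0ℚ; _+_; _*_; _-_; -_; _≤_; _<_; ∣_∣; _/_)
open import Data.Rational.Properties using (_≟_)
open import Data.Fin using (Fin)
open import Data.Vec using (Vec; lookup; zipWith; replicate; map; foldr)
open import Data.List as L using (List; []; _∷_; _++_; filter; concatMap; allFin; length; removeAt)
open import Data.Product using (Σ; ∃; _×_)
open import Relation.Binary.PropositionalEquality using (_≡_; _≢_)
open import Relation.Nullary using (¬_; does)

-- Points of ℚ^d (the cone K ⊂ ℝ^d is rational, and all statements are
-- about its rational / lattice points).
Pt : ℕ → Set
Pt d = Vec ℚ d

Subset : ℕ → Set₁
Subset d = Pt d → Set

module _ {d : ℕ} where

  𝟘 : Pt d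
  𝟘 = replicate d 0ℚ

  _⊕_ : Pt d → Pt d → Pt d
  _⊕_ = zipWith _+_

  _⊖_ : Pt d → Pt d → Pt d
  _⊖_ = zipWith _-_

  ⊝_ : Pt d → Pt d
  ⊝ x = map -_ x

  _·_ : ℚ → Pt d → Pt d
  c · x = map (c *_) x

  ⟨_,_⟩ : Pt d → Pt d → ℚ
  ⟨ x , y ⟩ = foldr (λ _ → ℚ) _+_ 0ℚ (zipWith _*_ x y)

  ∑ : List (Pt d) → Pt d
  ∑ = L.foldr _⊕_ 𝟘

  Integral : Pt d → Set
  Integral x = ∀ (i : Fin d) → ∃ λ (z : ℤ) → lookup x i ≡ z / 1

  InCone : List (Pt d) → Pt d → Set
  InCone []      x = x ≡ 𝟘
  InCone (g ∷ G) x = Σ ℚ λ c → (0ℚ ≤ c) × InCone G (x ⊖ (c · g))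

  InSemigroup : List (Pt d) → Pt d → Set
  InSemigroup []      x = x ≡ 𝟘
  InSemigroup (a ∷ A) x = Σ ℕ λ n → InSemigroup A (x ⊖ ((+ n / 1) · a))

  InLattice : List (Pt d) → Pt d → Set
  InLattice []      x = x ≡ 𝟘
  InLattice (a ∷ A) x = Σ ℤ λ z → InLattice A (x ⊖ ((z / 1) · a))

  _⊆_ : Subset d → Subset d → Set
  F ⊆ G = ∀ x → F x → G x

  _≐_ : Subset d → Subset d → Set
  F ≐ G = (F ⊆ G) × (G ⊆ F)

  Pointed : Subset d → Set
  Pointed K = ∀ x → K x → K (⊝ x) → x ≡ 𝟘

  NonemptyInterior : Subset d → Set
  NonemptyInterior K =
    Σ (Pt d) λ x → Σ ℚ λ ε → (0ℚ < ε) ×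
      (∀ y → (∀ i → ∣ lookup y i - lookup x i ∣ ≤ ε) → K y)

  IsHilbertBasis : Subset d → List (Pt d) → Set
  IsHilbertBasis K B =
    (∀ b → b L.∈ B → K b × Integral b) ×
    (∀ x → K x → Integral x → InSemigroup B x) ×
    (∀ (j : Fin (length B)) →
       ¬ (∀ x → K x → Integral x → InSemigroup (removeAt B j) x))
    where import Data.List.Membership.Propositional as L

  Supporting : Subset d → Pt d → Set
  Supporting K h = ∀ x → K x → 0ℚ ≤ ⟨ h , x ⟩

  FaceOf : Subset d → Pt d → Subset d
  FaceOf K h x = K x × (⟨ h , x ⟩ ≡ 0ℚ)

  IsFace : Subset d → Subset d → Set
  IsFace K F = Σ (Pt d) λ h → Supporting K h × (F ≐ FaceOf K h)

  -- b*_F = sum of the Hilbert basis elements lying on the face K ∩ h^⊥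
  -- (elements of B lie in K, so b ∈ F iff ⟨h,b⟩ = 0)
  bStar : List (Pt d) → Pt d → Pt d
  bStar B h = ∑ (filter (λ b → ⟨ h , b ⟩ ≟ 0ℚ) B)

  genA : List (Pt d) → {M : ℕ} → (Fin M → Pt d) → List (Pt d)
  genA B {M} h =
    L.map (λ b → (+ 2 / 1) · b) B ++
    concatMap (λ i → L.map (λ b → ((+ 2 / 1) · bStar B (h i)) ⊕ b) (𝟘 ∷ B))
              (allFin M)

  -- saturation point of Q(A), with Q_sat = K ∩ ℤ^d
  SaturationPoint : Subset d → List (Pt d) → Pt d → Set
  SaturationPoint K A a =
    InSemigroup A a × (∀ y → K y → Integral y → InSemigroup A (a ⊕ y))

  AlmostSaturated : Subset d → List (Pt d) → Subset d → Set
  AlmostSaturated K A F = Σ (Pt d) λ a → F a × SaturationPoint K A a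

  MinimalAlmostSaturated : Subset d → List (Pt d) → Subset d → Set₁
  MinimalAlmostSaturated K A F =
    AlmostSaturated K A F ×
    (∀ G → IsFace K G → G ⊆ F → ¬ (F ⊆ G) → ¬ AlmostSaturated K A G)

module Submission where

-- Each b ∈ B is ½·2b with 2b ∈ A, and also the difference (2b*ᵢ + b) − (2b*ᵢ + 0) of two elements
-- of A; this gives (i) and (ii). For (iii), a = |B|·2b*ᵢ is a saturation point on Fᵢ: writing
-- y ∈ K ∩ ℤᵈ as Σ n_b b, each 2b*ᵢ + n_b b is 2b*ᵢ or 2b*ᵢ + b plus a multiple of 2b.
-- Conversely, let a be a saturation point on a face F = K ∩ g^⊥. If some b*ⱼ lies on F then so
-- does every b ∈ B ∩ Fⱼ, and these generate Fⱼ, so Fⱼ ⊆ F. Otherwise the only generators of A on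
-- F are the 2b, hence Q(A) ∩ F ⊆ 2ℤᵈ. If some b ∈ B lies on F, then a and a + b are in 2ℤᵈ, so
-- b = b/2 + b/2 with b/2 ∈ K ∩ ℤᵈ, contradicting irreducibility of b. If none does, then a = 0,
-- so B ⊆ Q(A), hence B ⊆ A by irreducibility; but 2b = b + b and 2b*ⱼ + b′ = b*ⱼ + (b*ⱼ + b′) are
-- reducible. The antichain condition then identifies the minimal almost saturated faces.

open import Defs
open import Data.Nat using (ℕ; _≥_)
open import Data.Fin using (Fin)
open import Data.List using (List)
open import Data.Product using (Σ; ∃; _×_)
open import Function.Bundles using (_⇔_)
open import Relation.Binary.PropositionalEquality using (_≢_)
open import Relation.Nullary using (¬_)

open import Algebra.Bundles using (AbelianGroup; CommutativeMonoid)
import Algebra.Properties.AbelianGroup as AbelianGroupProperties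
import Algebra.Properties.CommutativeSemigroup as CommutativeSemigroupProperties
open import Algebra.Structures using (IsAbelianGroup)
open import Data.Empty using (⊥; ⊥-elim)
open import Data.Fin using (zero; suc)
import Data.Fin.Properties as Fin
open import Data.Integer as ℤ using (ℤ; +_; -[1+_])
import Data.Integer.Properties as ℤ
open import Data.List as List using ([]; _∷_; removeAt; lookup; length; filter; allFin)
open import Data.List.Membership.Propositional using (_∈_; find; lose)
open import Data.List.Membership.Propositional.Properties
  using (∈-filter⁺; ∈-filter⁻; ∈-map⁺; ∈-map⁻; ∈-++⁺ˡ; ∈-++⁺ʳ; ∈-++⁻
        ; ∈-concatMap⁺; ∈-concatMap⁻; ∈-allFin)
open import Data.List.Relation.Unary.Any using (here; there; index)
open import Data.List.Relation.Unary.Any.Properties using (lookup-index)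
import Data.Nat as ℕ
import Data.Nat.Properties as ℕ
open import Data.Product using (_,_; proj₁; proj₂)
open import Data.Rational
  using (ℚ; mkℚ; 0ℚ; 1ℚ; ½; _+_; _*_; -_; _≤_; _/_; 1/_; toℚᵘ; Positive; ≢-nonZero; nonNegative)
open import Data.Rational.Properties
import Data.Rational.Unnormalised as ℚᵘ
import Data.Rational.Unnormalised.Properties as ℚᵘ
open import Data.Sum as Sum using (_⊎_; inj₁; inj₂; [_,_]′)
open import Data.Vec using ([]; _∷_; replicate)
import Data.Vec.Properties as Vec
open import Function using (_$_; _∘_; id)
open import Function.Bundles using (mk⇔)
open import Level using (0ℓ)
open import Relation.Binary.PropositionalEquality
  using (_≡_; refl; sym; trans; cong; cong₂; subst; isEquivalence; module ≡-Reasoning)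
open import Relation.Nullary using (Dec; yes; no)

private
  variable
    d : ℕ
    x y g h : Pt d
    L L′ : List (Pt d)
    S : Subset d
    T : Set

fromℤ : ℤ → ℚ
fromℤ z = z / 1

toℚᵘ-fromℤ : ∀ z → toℚᵘ (fromℤ z) ℚᵘ.≃ ℚᵘ.mkℚᵘ z 0
toℚᵘ-fromℤ z = toℚᵘ-fromℚᵘ (ℚᵘ.mkℚᵘ z 0)

fromℤ-homo-+ : ∀ z w → fromℤ (z ℤ.+ w) ≡ fromℤ z + fromℤ w
fromℤ-homo-+ z w = toℚᵘ-injective $ begin
  toℚᵘ (fromℤ (z ℤ.+ w))                  ≈⟨ toℚᵘ-fromℤ (z ℤ.+ w) ⟩
  ℚᵘ.mkℚᵘ (z ℤ.+ w) 0                     ≈⟨ ℚᵘ.*≡* (cong (ℤ._* + 1) (sym z*1+w*1≡z+w)) ⟩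
  ℚᵘ.mkℚᵘ z 0 ℚᵘ.+ ℚᵘ.mkℚᵘ w 0            ≈⟨ ℚᵘ.+-cong (toℚᵘ-fromℤ z) (toℚᵘ-fromℤ w) ⟨
  toℚᵘ (fromℤ z) ℚᵘ.+ toℚᵘ (fromℤ w)      ≈⟨ toℚᵘ-homo-+ (fromℤ z) (fromℤ w) ⟨
  toℚᵘ (fromℤ z + fromℤ w)                ∎
  where
  open ℚᵘ.≃-Reasoning
  z*1+w*1≡z+w : z ℤ.* + 1 ℤ.+ w ℤ.* + 1 ≡ z ℤ.+ w
  z*1+w*1≡z+w = cong₂ ℤ._+_ (ℤ.*-identityʳ z) (ℤ.*-identityʳ w)

fromℤ-homo-* : ∀ z w → fromℤ (z ℤ.* w) ≡ fromℤ z * fromℤ w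
fromℤ-homo-* z w = toℚᵘ-injective $ begin
  toℚᵘ (fromℤ (z ℤ.* w))                  ≈⟨ toℚᵘ-fromℤ (z ℤ.* w) ⟩
  ℚᵘ.mkℚᵘ z 0 ℚᵘ.* ℚᵘ.mkℚᵘ w 0            ≈⟨ ℚᵘ.*-cong (toℚᵘ-fromℤ z) (toℚᵘ-fromℤ w) ⟨
  toℚᵘ (fromℤ z) ℚᵘ.* toℚᵘ (fromℤ w)      ≈⟨ toℚᵘ-homo-* (fromℤ z) (fromℤ w) ⟨
  toℚᵘ (fromℤ z * fromℤ w)                ∎
  where open ℚᵘ.≃-Reasoning

IsNatural IsInteger : ℚ → Set
IsNatural p = ∃ λ n → p ≡ fromℤ (+ n)
IsInteger p = ∃ λ z → p ≡ fromℤ z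

record IsSubsemiring (P : ℚ → Set) : Set where
  field
    0∈       : P 0ℚ
    1∈       : P 1ℚ
    +-closed : ∀ {p q} → P p → P q → P (p + q)
    *-closed : ∀ {p q} → P p → P q → P (p * q)

nonNegative-isSubsemiring : IsSubsemiring (0ℚ ≤_)
nonNegative-isSubsemiring = record
  { 0∈       = ≤-refl
  ; 1∈       = nonNegative⁻¹ 1ℚ
  ; +-closed = +-mono-≤
  ; *-closed = λ {p} {q} 0≤p 0≤q →
      nonNegative⁻¹ _ {{nonNeg*nonNeg⇒nonNeg p {{nonNegative 0≤p}} q {{nonNegative 0≤q}}}}
  }

natural-isSubsemiring : IsSubsemiring IsNatural
natural-isSubsemiring = record
  { 0∈       = 0 , refl
  ; 1∈       = 1 , refl
  ; +-closed = λ { (m , refl) (n , refl) → m ℕ.+ n , sym (fromℤ-homo-+ (+ m) (+ n)) }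
  ; *-closed = λ { (m , refl) (n , refl) →
      m ℕ.* n , trans (sym (fromℤ-homo-* (+ m) (+ n))) (cong fromℤ (sym (ℤ.pos-* m n))) }
  }

integer-isSubsemiring : IsSubsemiring IsInteger
integer-isSubsemiring = record
  { 0∈       = + 0 , refl
  ; 1∈       = + 1 , refl
  ; +-closed = λ { (z , refl) (w , refl) → z ℤ.+ w , sym (fromℤ-homo-+ z w) }
  ; *-closed = λ { (z , refl) (w , refl) → z ℤ.* w , sym (fromℤ-homo-* z w) }
  }

natural⇒nonNegative : ∀ {p} → IsNatural p → 0ℚ ≤ p
natural⇒nonNegative (n , refl) = nonNegative⁻¹ _ {{normalize-nonNeg n 1}}

natural⇒integer : ∀ {p} → IsNatural p → IsInteger p
natural⇒integer (n , p≡n) = + n , p≡n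

-1-integer : IsInteger (- 1ℚ)
-1-integer = -[1+ 0 ] , refl

p*q≡0⇒p≡0∨q≡0 : ∀ p q → p * q ≡ 0ℚ → p ≡ 0ℚ ⊎ q ≡ 0ℚ
p*q≡0⇒p≡0∨q≡0 p q p*q≡0 with p ≟ 0ℚ
... | yes p≡0 = inj₁ p≡0
... | no  p≢0 = inj₂ $ begin
  q                  ≡⟨ *-identityˡ q ⟨
  1ℚ * q             ≡⟨ cong (_* q) (*-inverseˡ p) ⟨
  (p⁻¹ * p) * q      ≡⟨ *-assoc p⁻¹ p q ⟩
  p⁻¹ * (p * q)      ≡⟨ cong (p⁻¹ *_) p*q≡0 ⟩
  p⁻¹ * 0ℚ           ≡⟨ *-zeroʳ p⁻¹ ⟩
  0ℚ                 ∎
  where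
  open ≡-Reasoning
  instance _ = ≢-nonZero p≢0
  p⁻¹ = 1/ p

nonNeg+nonNeg≡0⇒≡0 : ∀ {p q} → 0ℚ ≤ p → 0ℚ ≤ q → p + q ≡ 0ℚ → p ≡ 0ℚ × q ≡ 0ℚ
nonNeg+nonNeg≡0⇒≡0 {p} {q} 0≤p 0≤q p+q≡0 = left 0≤p 0≤q p+q≡0 , left 0≤q 0≤p (trans (+-comm q p) p+q≡0)
  where
  left : ∀ {p q} → 0ℚ ≤ p → 0ℚ ≤ q → p + q ≡ 0ℚ → p ≡ 0ℚ
  left {p} {q} 0≤p 0≤q p+q≡0 = ≤-antisym p≤0 0≤p
    where
    open ≤-Reasoning
    p≤0 : p ≤ 0ℚ
    p≤0 = begin
      p        ≡⟨ +-identityʳ p ⟨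
      p + 0ℚ   ≤⟨ +-monoʳ-≤ p 0≤q ⟩
      p + q    ≡⟨ p+q≡0 ⟩
      0ℚ       ∎

private
  module +-Properties = CommutativeSemigroupProperties (CommutativeMonoid.commutativeSemigroup +-0-commutativeMonoid)
  module *-Properties = CommutativeSemigroupProperties (CommutativeMonoid.commutativeSemigroup *-1-commutativeMonoid)

⊕-assoc : (x y z : Pt d) → (x ⊕ y) ⊕ z ≡ x ⊕ (y ⊕ z)
⊕-assoc = Vec.zipWith-assoc +-assoc

⊕-comm : (x y : Pt d) → x ⊕ y ≡ y ⊕ x
⊕-comm = Vec.zipWith-comm +-comm

⊕-identityˡ : (x : Pt d) → 𝟘 ⊕ x ≡ x
⊕-identityˡ = Vec.zipWith-identityˡ +-identityˡ

⊕-identityʳ : (x : Pt d) → x ⊕ 𝟘 ≡ x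
⊕-identityʳ = Vec.zipWith-identityʳ +-identityʳ

⊕-inverseˡ : (x : Pt d) → (⊝ x) ⊕ x ≡ 𝟘
⊕-inverseˡ = Vec.zipWith-inverseˡ +-inverseˡ

⊕-inverseʳ : (x : Pt d) → x ⊕ (⊝ x) ≡ 𝟘
⊕-inverseʳ = Vec.zipWith-inverseʳ +-inverseʳ

x⊖y≡x⊕⊝y : (x y : Pt d) → x ⊖ y ≡ x ⊕ (⊝ y)
x⊖y≡x⊕⊝y x y = sym (Vec.zipWith-map₂ _+_ -_ x y)

⊝x≡-1·x : (x : Pt d) → ⊝ x ≡ (- 1ℚ) · x
⊝x≡-1·x x = Vec.map-cong (λ p → trans (cong -_ (sym (*-identityˡ p))) (neg-distribˡ-* 1ℚ p)) x

·-distribˡ-⊕ : ∀ c (x y : Pt d) → c · (x ⊕ y) ≡ (c · x) ⊕ (c · y)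
·-distribˡ-⊕ c []      []      = refl
·-distribˡ-⊕ c (p ∷ x) (q ∷ y) = cong₂ _∷_ (*-distribˡ-+ c p q) (·-distribˡ-⊕ c x y)

·-distribʳ-+ : ∀ c e (x : Pt d) → (c + e) · x ≡ (c · x) ⊕ (e · x)
·-distribʳ-+ c e []      = refl
·-distribʳ-+ c e (p ∷ x) = cong₂ _∷_ (*-distribʳ-+ p c e) (·-distribʳ-+ c e x)

·-assoc : ∀ c e (x : Pt d) → (c * e) · x ≡ c · (e · x)
·-assoc c e x = trans (Vec.map-cong (*-assoc c e) x) (Vec.map-∘ (c *_) (e *_) x)

·-identityˡ : (x : Pt d) → 1ℚ · x ≡ x
·-identityˡ x = trans (Vec.map-cong *-identityˡ x) (Vec.map-id x)

·-zeroˡ : (x : Pt d) → 0ℚ · x ≡ 𝟘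
·-zeroˡ x = trans (Vec.map-cong *-zeroˡ x) (Vec.map-const x 0ℚ)

·-zeroʳ : ∀ {d} c → c · 𝟘 {d} ≡ 𝟘
·-zeroʳ {d} c = trans (Vec.map-replicate (c *_) 0ℚ d) (cong (replicate d) (*-zeroʳ c))

⟨,⟩-zeroʳ : (h : Pt d) → ⟨ h , 𝟘 ⟩ ≡ 0ℚ
⟨,⟩-zeroʳ []      = refl
⟨,⟩-zeroʳ (a ∷ h) = trans (cong₂ _+_ (*-zeroʳ a) (⟨,⟩-zeroʳ h)) (+-identityˡ 0ℚ)

⟨,⟩-distribˡ-⊕ : (h x y : Pt d) → ⟨ h , x ⊕ y ⟩ ≡ ⟨ h , x ⟩ + ⟨ h , y ⟩
⟨,⟩-distribˡ-⊕ []      []      []      = refl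
⟨,⟩-distribˡ-⊕ (a ∷ h) (p ∷ x) (q ∷ y) = begin
  a * (p + q) + ⟨ h , x ⊕ y ⟩                 ≡⟨ cong₂ _+_ (*-distribˡ-+ a p q) (⟨,⟩-distribˡ-⊕ h x y) ⟩
  (a * p + a * q) + (⟨ h , x ⟩ + ⟨ h , y ⟩)    ≡⟨ +-Properties.interchange (a * p) (a * q) ⟨ h , x ⟩ ⟨ h , y ⟩ ⟩
  (a * p + ⟨ h , x ⟩) + (a * q + ⟨ h , y ⟩)    ∎
  where open ≡-Reasoning

⟨,⟩-homoˡ-· : ∀ (h : Pt d) c x → ⟨ h , c · x ⟩ ≡ c * ⟨ h , x ⟩
⟨,⟩-homoˡ-· []      c []      = sym (*-zeroʳ c)
⟨,⟩-homoˡ-· (a ∷ h) c (p ∷ x) = begin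
  a * (c * p) + ⟨ h , c · x ⟩    ≡⟨ cong₂ _+_ (*-Properties.x∙yz≈y∙xz a c p) (⟨,⟩-homoˡ-· h c x) ⟩
  c * (a * p) + c * ⟨ h , x ⟩    ≡⟨ *-distribˡ-+ c (a * p) ⟨ h , x ⟩ ⟨
  c * (a * p + ⟨ h , x ⟩)        ∎
  where open ≡-Reasoning

⊕-isAbelianGroup : IsAbelianGroup {A = Pt d} _≡_ _⊕_ 𝟘 ⊝_
⊕-isAbelianGroup = record
  { isGroup = record
    { isMonoid = record
      { isSemigroup = record
        { isMagma = record { isEquivalence = isEquivalence ; ∙-cong = cong₂ _⊕_ }
        ; assoc   = ⊕-assoc
        }
      ; identity = ⊕-identityˡ , ⊕-identityʳ
      }
    ; inverse = ⊕-inverseˡ , ⊕-inverseʳ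
    ; ⁻¹-cong = cong ⊝_
    }
  ; comm = ⊕-comm
  }

⊕-abelianGroup : ℕ → AbelianGroup 0ℓ 0ℓ
⊕-abelianGroup d = record { isAbelianGroup = ⊕-isAbelianGroup {d} }

module ⊕-Properties {d : ℕ} where
  open AbelianGroupProperties (⊕-abelianGroup d) public
  open CommutativeSemigroupProperties (AbelianGroup.commutativeSemigroup (⊕-abelianGroup d)) public

x⊕y⊖y≡x : (x y : Pt d) → (x ⊕ y) ⊖ y ≡ x
x⊕y⊖y≡x x y = trans (x⊖y≡x⊕⊝y (x ⊕ y) y) (⊕-Properties.//-rightDividesʳ y x)

x⊖y⊕y≡x : (x y : Pt d) → (x ⊖ y) ⊕ y ≡ x
x⊖y⊕y≡x x y = trans (cong (_⊕ y) (x⊖y≡x⊕⊝y x y)) (⊕-Properties.//-rightDividesˡ y x)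

-- Combinations with coefficients in a subsemiring of ℚ

record IsSubmonoid (S : Subset d) : Set where
  field
    𝟘∈       : S 𝟘
    ⊕-closed : ∀ {x y} → S x → S y → S (x ⊕ y)

-- InCone, InSemigroup and InLattice are the cases P = (0ℚ ≤_), IsNatural and IsInteger.
Span : (ℚ → Set) → List (Pt d) → Subset d
Span P []      x = x ≡ 𝟘
Span P (g ∷ L) x = Σ ℚ λ c → P c × Span P L (x ⊖ (c · g))

module _ {P : ℚ → Set} where

  span-∷⁺ : ∀ {c} → P c → Span P L y → Span P (g ∷ L) (y ⊕ (c · g))
  span-∷⁺ {L = L} {y = y} {g = g} {c} Pc y∈ = c , Pc , subst (Span P L) (sym (x⊕y⊖y≡x y (c · g))) y∈

  span-∷⁻ : Span P (g ∷ L) x → Σ ℚ λ c → Σ (Pt d) λ y → P c × Span P L y × x ≡ y ⊕ (c · g)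
  span-∷⁻ {g = g} {x = x} (c , Pc , y∈) = c , x ⊖ (c · g) , Pc , y∈ , sym (x⊖y⊕y≡x x (c · g))

  span-ind : (S : Subset d) → IsSubmonoid S → (∀ {c l} → P c → l ∈ L → S (c · l)) → Span P L x → S x
  span-ind {L = []}    S S-sub gen refl = IsSubmonoid.𝟘∈ S-sub
  span-ind {L = g ∷ L} S S-sub gen x∈ with span-∷⁻ x∈
  ... | c , y , Pc , y∈ , refl =
    IsSubmonoid.⊕-closed S-sub (span-ind S S-sub (λ Pc′ l∈ → gen Pc′ (there l∈)) y∈) (gen Pc (here refl))

  span-mono : ∀ {Q} → (∀ {c} → P c → Q c) → Span P L x → Span Q L x
  span-mono {L = []}    P⊆Q x≡𝟘           = x≡𝟘
  span-mono {L = g ∷ L} P⊆Q (c , Pc , y∈) = c , P⊆Q Pc , span-mono P⊆Q y∈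

module SpanProperties {P : ℚ → Set} (P-isSubsemiring : IsSubsemiring P) where
  open IsSubsemiring P-isSubsemiring

  span-𝟘 : Span P L 𝟘
  span-𝟘 {L = []}    = refl
  span-𝟘 {L = g ∷ L} = subst (Span P (g ∷ L)) 𝟘⊕0·g≡𝟘 (span-∷⁺ 0∈ span-𝟘)
    where
    𝟘⊕0·g≡𝟘 : 𝟘 ⊕ (0ℚ · g) ≡ 𝟘
    𝟘⊕0·g≡𝟘 = trans (⊕-identityˡ (0ℚ · g)) (·-zeroˡ g)

  span-⊕ : Span P L x → Span P L y → Span P L (x ⊕ y)
  span-⊕ {L = []}    refl refl = ⊕-identityʳ 𝟘
  span-⊕ {L = g ∷ L} x∈ y∈ with span-∷⁻ x∈ | span-∷⁻ y∈
  ... | c , x′ , Pc , x′∈ , refl | e , y′ , Pe , y′∈ , refl =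
    subst (Span P (g ∷ L)) (sym regroup) (span-∷⁺ (+-closed Pc Pe) (span-⊕ x′∈ y′∈))
    where
    regroup : (x′ ⊕ (c · g)) ⊕ (y′ ⊕ (e · g)) ≡ (x′ ⊕ y′) ⊕ ((c + e) · g)
    regroup = trans (⊕-Properties.interchange x′ (c · g) y′ (e · g))
                    (cong ((x′ ⊕ y′) ⊕_) (sym (·-distribʳ-+ c e g)))

  span-· : ∀ {k} → P k → Span P L x → Span P L (k · x)
  span-· {L = []}    {k = k} Pk refl = ·-zeroʳ k
  span-· {L = g ∷ L} {k = k} Pk x∈ with span-∷⁻ x∈
  ... | c , y , Pc , y∈ , refl =
    subst (Span P (g ∷ L)) (sym distrib) (span-∷⁺ (*-closed Pk Pc) (span-· Pk y∈))
    where
    distrib : k · (y ⊕ (c · g)) ≡ (k · y) ⊕ ((k * c) · g)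
    distrib = trans (·-distribˡ-⊕ k y (c · g)) (cong ((k · y) ⊕_) (sym (·-assoc k c g)))

  span-∈ : g ∈ L → Span P L g
  span-∈ {g = g} {L = g ∷ L}  (here refl) =
    subst (Span P (g ∷ L)) (trans (⊕-identityˡ (1ℚ · g)) (·-identityˡ g)) (span-∷⁺ 1∈ span-𝟘)
  span-∈ {g = g} {L = g′ ∷ L} (there g∈) =
    subst (Span P (g′ ∷ L)) (trans (cong (g ⊕_) (·-zeroˡ g′)) (⊕-identityʳ g)) (span-∷⁺ 0∈ (span-∈ g∈))

  span-isSubmonoid : IsSubmonoid (Span P L)
  span-isSubmonoid = record { 𝟘∈ = span-𝟘 ; ⊕-closed = span-⊕ }

  span-sub : (∀ {l} → l ∈ L → Span P L′ l) → Span P L x → Span P L′ x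
  span-sub L⊆L′ = span-ind _ span-isSubmonoid (λ Pc l∈ → span-· Pc (L⊆L′ l∈))

InCone⇒Span : InCone L x → Span (0ℚ ≤_) L x
InCone⇒Span {L = []}    x≡𝟘             = x≡𝟘
InCone⇒Span {L = g ∷ L} (c , 0≤c , y∈) = c , 0≤c , InCone⇒Span y∈

Span⇒InCone : Span (0ℚ ≤_) L x → InCone L x
Span⇒InCone {L = []}    x≡𝟘             = x≡𝟘
Span⇒InCone {L = g ∷ L} (c , 0≤c , y∈) = c , 0≤c , Span⇒InCone y∈

InSemigroup⇒Span : InSemigroup L x → Span IsNatural L x
InSemigroup⇒Span {L = []}    x≡𝟘     = x≡𝟘
InSemigroup⇒Span {L = g ∷ L} (n , y∈) = fromℤ (+ n) , (n , refl) , InSemigroup⇒Span y∈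

Span⇒InSemigroup : Span IsNatural L x → InSemigroup L x
Span⇒InSemigroup {L = []}    x≡𝟘                 = x≡𝟘
Span⇒InSemigroup {L = g ∷ L} (_ , (n , refl) , y∈) = n , Span⇒InSemigroup y∈

InLattice⇒Span : InLattice L x → Span IsInteger L x
InLattice⇒Span {L = []}    x≡𝟘     = x≡𝟘
InLattice⇒Span {L = g ∷ L} (z , y∈) = fromℤ z , (z , refl) , InLattice⇒Span y∈

Span⇒InLattice : Span IsInteger L x → InLattice L x
Span⇒InLattice {L = []}    x≡𝟘                 = x≡𝟘
Span⇒InLattice {L = g ∷ L} (_ , (z , refl) , y∈) = z , Span⇒InLattice y∈

module Cone      = SpanProperties nonNegative-isSubsemiring
module Semigroup = SpanProperties natural-isSubsemiring
module Lattice   = SpanProperties integer-isSubsemiring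

-- Hyperplanes

_⟂_ : Pt d → Pt d → Set
h ⟂ x = ⟨ h , x ⟩ ≡ 0ℚ

_⟂?_ : (h x : Pt d) → Dec (h ⟂ x)
h ⟂? x = ⟨ h , x ⟩ ≟ 0ℚ

⟂-isSubmonoid : (h : Pt d) → IsSubmonoid (h ⟂_)
⟂-isSubmonoid h = record
  { 𝟘∈       = ⟨,⟩-zeroʳ h
  ; ⊕-closed = λ {x} {y} h⟂x h⟂y →
      trans (⟨,⟩-distribˡ-⊕ h x y) (trans (cong₂ _+_ h⟂x h⟂y) (+-identityˡ 0ℚ))
  }

nonNeg-isSubmonoid : (h : Pt d) → IsSubmonoid (λ x → 0ℚ ≤ ⟨ h , x ⟩)
nonNeg-isSubmonoid h = record
  { 𝟘∈       = ≤-reflexive (sym (⟨,⟩-zeroʳ h))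
  ; ⊕-closed = λ {x} {y} 0≤hx 0≤hy → subst (0ℚ ≤_) (sym (⟨,⟩-distribˡ-⊕ h x y)) (+-mono-≤ 0≤hx 0≤hy)
  }

⟂-·⁺ : ∀ h c → h ⟂ x → h ⟂ (c · x)
⟂-·⁺ {x = x} h c h⟂x = trans (⟨,⟩-homoˡ-· h c x) (trans (cong (c *_) h⟂x) (*-zeroʳ c))

⟂-·⁻ : ∀ h c → h ⟂ (c · x) → c ≡ 0ℚ ⊎ h ⟂ x
⟂-·⁻ {x = x} h c h⟂cx = p*q≡0⇒p≡0∨q≡0 c ⟨ h , x ⟩ (trans (sym (⟨,⟩-homoˡ-· h c x)) h⟂cx)

⟂-⊕⁻ : ∀ h → 0ℚ ≤ ⟨ h , x ⟩ → 0ℚ ≤ ⟨ h , y ⟩ → h ⟂ (x ⊕ y) → h ⟂ x × h ⟂ y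
⟂-⊕⁻ {x = x} {y = y} h 0≤hx 0≤hy h⟂x⊕y =
  nonNeg+nonNeg≡0⇒≡0 0≤hx 0≤hy (trans (sym (⟨,⟩-distribˡ-⊕ h x y)) h⟂x⊕y)

nonNeg-·⁺ : ∀ h {c} → 0ℚ ≤ c → 0ℚ ≤ ⟨ h , x ⟩ → 0ℚ ≤ ⟨ h , c · x ⟩
nonNeg-·⁺ {x = x} h {c} 0≤c 0≤hx =
  subst (0ℚ ≤_) (sym (⟨,⟩-homoˡ-· h c x)) (IsSubsemiring.*-closed nonNegative-isSubsemiring 0≤c 0≤hx)

module _ {P : ℚ → Set} (P⇒nonNeg : ∀ {c} → P c → 0ℚ ≤ c) where

  span-nonNeg : ∀ h → (∀ {l} → l ∈ L → 0ℚ ≤ ⟨ h , l ⟩) → Span P L x → 0ℚ ≤ ⟨ h , x ⟩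
  span-nonNeg h L≥0 = span-ind _ (nonNeg-isSubmonoid h) (λ Pc l∈ → nonNeg-·⁺ h (P⇒nonNeg Pc) (L≥0 l∈))

  -- Every term of the combination lies in the half-space ⟨h, ·⟩ ≥ 0, so on the hyperplane only
  -- generators on the hyperplane contribute.
  span-⟂-ind : ∀ h → (∀ {l} → l ∈ L → 0ℚ ≤ ⟨ h , l ⟩) → IsSubmonoid S →
               (∀ {c l} → P c → l ∈ L → h ⟂ l → S (c · l)) →
               Span P L x → h ⟂ x → S x
  span-⟂-ind {L = []}    h L≥0 S-sub gen refl h⟂x = IsSubmonoid.𝟘∈ S-sub
  span-⟂-ind {L = g ∷ L} {S = S} h L≥0 S-sub gen x∈ h⟂x with span-∷⁻ x∈
  ... | c , y , Pc , y∈ , refl =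
    IsSubmonoid.⊕-closed S-sub
      (span-⟂-ind h (L≥0 ∘ there) S-sub (λ Pc′ l∈ → gen Pc′ (there l∈)) y∈ h⟂y) S[c·g]
    where
    h⟂y×h⟂c·g : h ⟂ y × h ⟂ (c · g)
    h⟂y×h⟂c·g =
      ⟂-⊕⁻ h (span-nonNeg h (L≥0 ∘ there) y∈) (nonNeg-·⁺ h (P⇒nonNeg Pc) (L≥0 (here refl))) h⟂x
    h⟂y : h ⟂ y
    h⟂y = proj₁ h⟂y×h⟂c·g
    S[c·g] : S (c · g)
    S[c·g] with ⟂-·⁻ h c (proj₂ h⟂y×h⟂c·g)
    ... | inj₁ refl = subst S (sym (·-zeroˡ g)) (IsSubmonoid.𝟘∈ S-sub)
    ... | inj₂ h⟂g  = gen Pc (here refl) h⟂g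

∑-closed : IsSubmonoid S → (∀ {l} → l ∈ L → S l) → S (∑ L)
∑-closed {L = []}    S-sub L⊆S = IsSubmonoid.𝟘∈ S-sub
∑-closed {L = l ∷ L} S-sub L⊆S = IsSubmonoid.⊕-closed S-sub (L⊆S (here refl)) (∑-closed S-sub (L⊆S ∘ there))

∑-⟂⁻ : ∀ h → (∀ {l} → l ∈ L → 0ℚ ≤ ⟨ h , l ⟩) → h ⟂ ∑ L → ∀ {l} → l ∈ L → h ⟂ l
∑-⟂⁻ {L = l ∷ L} h L≥0 h⟂∑ l∈
  with ⟂-⊕⁻ h (L≥0 (here refl)) (∑-closed (nonNeg-isSubmonoid h) (L≥0 ∘ there)) h⟂∑
∑-⟂⁻ {L = l ∷ L} h L≥0 h⟂∑ (here refl) | h⟂l , _   = h⟂l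
∑-⟂⁻ {L = l ∷ L} h L≥0 h⟂∑ (there l∈)  | _ , h⟂∑′ = ∑-⟂⁻ h (L≥0 ∘ there) h⟂∑′ l∈

∑≢𝟘⇒∃∈ : ∑ L ≢ 𝟘 → ∃ λ l → l ∈ L
∑≢𝟘⇒∃∈ {L = []}    ∑≢𝟘 = ⊥-elim (∑≢𝟘 refl)
∑≢𝟘⇒∃∈ {L = l ∷ L} _   = l , here refl

_ℕ·_ : ℕ → Pt d → Pt d
n ℕ· x = fromℤ (+ n) · x

ℕ·-+ : ∀ m n (x : Pt d) → (m ℕ.+ n) ℕ· x ≡ (m ℕ· x) ⊕ (n ℕ· x)
ℕ·-+ m n x = trans (cong (_· x) (fromℤ-homo-+ (+ m) (+ n))) (·-distribʳ-+ (fromℤ (+ m)) (fromℤ (+ n)) x)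

ℕ·-suc : ∀ n (x : Pt d) → ℕ.suc n ℕ· x ≡ x ⊕ (n ℕ· x)
ℕ·-suc n x = trans (ℕ·-+ 1 n x) (cong (_⊕ (n ℕ· x)) (·-identityˡ x))

submonoid-ℕ· : IsSubmonoid S → S x → ∀ n → S (n ℕ· x)
submonoid-ℕ· {S = S} {x = x} S-sub Sx ℕ.zero    = subst S (sym (·-zeroˡ x)) (IsSubmonoid.𝟘∈ S-sub)
submonoid-ℕ· {S = S} {x = x} S-sub Sx (ℕ.suc n) =
  subst S (sym (ℕ·-suc n x)) (IsSubmonoid.⊕-closed S-sub Sx (submonoid-ℕ· S-sub Sx n))

semigroup⊆submonoid : IsSubmonoid S → (∀ {l} → l ∈ L → S l) → Span IsNatural L x → S x
semigroup⊆submonoid S-sub L⊆S =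
  span-ind _ S-sub (λ { {l = l} (n , refl) l∈ → submonoid-ℕ· {x = l} S-sub (L⊆S l∈) n })

integral-isSubmonoid : IsSubmonoid (Integral {d})
integral-isSubmonoid = record
  { 𝟘∈       = λ i → subst IsInteger (sym (Vec.lookup-replicate i 0ℚ)) 0∈
  ; ⊕-closed = λ {x} {y} Ix Iy i → subst IsInteger (sym (Vec.lookup-zipWith _+_ i x y)) (+-closed (Ix i) (Iy i))
  }
  where open IsSubsemiring integer-isSubsemiring

integral-· : ∀ {c} → IsInteger c → Integral x → Integral (c · x)
integral-· {x = x} {c} Ic Ix i =
  subst IsInteger (sym (Vec.lookup-map i (c *_) x)) (IsSubsemiring.*-closed integer-isSubsemiring Ic (Ix i))

integral-⊖ : Integral x → Integral y → Integral (x ⊖ y)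
integral-⊖ {x = x} {y = y} Ix Iy =
  subst Integral (sym (x⊖y≡x⊕⊝y x y))
    (IsSubmonoid.⊕-closed integral-isSubmonoid {x} {⊝ y} Ix
      (subst Integral (sym (⊝x≡-1·x y)) (integral-· {x = y} -1-integer Iy)))

lattice⊆integral : (∀ {l} → l ∈ L → Integral l) → Span IsInteger L x → Integral x
lattice⊆integral L⊆ℤ = span-ind _ integral-isSubmonoid (λ {_} {l} Ic l∈ → integral-· {x = l} Ic (L⊆ℤ l∈))

clear-denominator : ∀ p → Σ ℚ λ c → Positive c × IsInteger c × IsInteger (c * p)
clear-denominator p@(mkℚ n k _) = fromℤ (+ ℕ.suc k) , normalize-pos (ℕ.suc k) 1 , (+ ℕ.suc k , refl) , (n , c*p≡n)
  where
  c*p≡n : fromℤ (+ ℕ.suc k) * p ≡ fromℤ n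
  c*p≡n = toℚᵘ-injective $ begin
    toℚᵘ (fromℤ (+ ℕ.suc k) * p)                    ≈⟨ toℚᵘ-homo-* (fromℤ (+ ℕ.suc k)) p ⟩
    toℚᵘ (fromℤ (+ ℕ.suc k)) ℚᵘ.* ℚᵘ.mkℚᵘ n k       ≈⟨ ℚᵘ.*-congʳ (toℚᵘ-fromℤ (+ ℕ.suc k)) ⟩
    ℚᵘ.mkℚᵘ (+ ℕ.suc k) 0 ℚᵘ.* ℚᵘ.mkℚᵘ n k          ≈⟨ ℚᵘ.*≡* cross ⟩
    ℚᵘ.mkℚᵘ n 0                                     ≈⟨ toℚᵘ-fromℤ n ⟨
    toℚᵘ (fromℤ n)                                  ∎
    where
    open ℚᵘ.≃-Reasoning
    cross : (+ ℕ.suc k ℤ.* n) ℤ.* + 1 ≡ n ℤ.* + (ℕ.suc k ℕ.+ 0)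
    cross = trans (ℤ.*-identityʳ _)
                  (trans (ℤ.*-comm (+ ℕ.suc k) n) (cong (λ m → n ℤ.* + m) (sym (ℕ.+-identityʳ (ℕ.suc k)))))

clear-denominators : (x : Pt d) → Σ ℚ λ c → Positive c × IsInteger c × Integral (c · x)
clear-denominators []      = 1ℚ , _ , (+ 1 , refl) , λ ()
clear-denominators (p ∷ x) with clear-denominator p | clear-denominators x
... | c , c>0 , Ic , Icp | e , e>0 , Ie , Iex =
  e * c , pos*pos⇒pos e {{e>0}} c {{c>0}} , *-closed Ie Ic , λ where
    zero    → subst IsInteger (sym (*-assoc e c p)) (*-closed Ie Icp)
    (suc i) → subst Integral (sym ec·x≡c·ex) (integral-· {x = e · x} Ic Iex) i
  where
  open IsSubsemiring integer-isSubsemiring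
  ec·x≡c·ex : (e * c) · x ≡ c · (e · x)
  ec·x≡c·ex = trans (cong (_· x) (*-comm e c)) (·-assoc c e x)

-- Pointed cones and Hilbert bases

x⊕y≡𝟘⇒y≡𝟘 : ∀ {K : Subset d} → Pointed K → K x → K y → x ⊕ y ≡ 𝟘 → y ≡ 𝟘
x⊕y≡𝟘⇒y≡𝟘 {x = x} {y = y} {K = K} pointed Kx Ky x⊕y≡𝟘 =
  pointed y Ky (subst K (⊕-Properties.inverseˡ-unique x y x⊕y≡𝟘) Kx)

semigroup-decompose : Span IsNatural L x → x ≢ 𝟘 →
                      Σ (Pt d) λ r → Σ (Pt d) λ l → Span IsNatural L r × l ∈ L × x ≡ r ⊕ l
semigroup-decompose {L = []}    x≡𝟘 x≢𝟘 = ⊥-elim (x≢𝟘 x≡𝟘)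
semigroup-decompose {L = g ∷ L} x∈ x≢𝟘 with span-∷⁻ x∈
... | _ , y , (ℕ.zero , refl) , y∈ , x≡y⊕0·g =
  let r , l , r∈ , l∈ , y≡r⊕l = semigroup-decompose y∈ (x≢𝟘 ∘ trans x≡y)
  in  r , l , Semigroup.span-sub (Semigroup.span-∈ ∘ there) r∈ , there l∈ , trans x≡y y≡r⊕l
  where
  x≡y : _ ≡ y
  x≡y = trans x≡y⊕0·g (trans (cong (y ⊕_) (·-zeroˡ g)) (⊕-identityʳ y))
... | _ , y , (ℕ.suc n , refl) , y∈ , x≡ =
  y ⊕ (n ℕ· g) , g , span-∷⁺ (n , refl) y∈ , here refl , trans x≡ regroup
  where
  regroup : y ⊕ (ℕ.suc n ℕ· g) ≡ (y ⊕ (n ℕ· g)) ⊕ g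
  regroup = trans (cong (y ⊕_) (trans (ℕ·-suc n g) (⊕-comm g (n ℕ· g)))) (sym (⊕-assoc y (n ℕ· g) g))

translate-semigroup⊆submonoid : ∀ s → IsSubmonoid S → (∀ {l} → l ∈ L → ∀ n → S (s ⊕ (n ℕ· l))) →
                                Span IsNatural L y → S ((length L ℕ· s) ⊕ y)
translate-semigroup⊆submonoid {S = S} {L = []} s S-sub gen refl =
  subst S (sym (trans (⊕-identityʳ (0 ℕ· s)) (·-zeroˡ s))) (IsSubmonoid.𝟘∈ S-sub)
translate-semigroup⊆submonoid {S = S} {L = l ∷ L} s S-sub gen y∈ with span-∷⁻ y∈
... | _ , y′ , (n , refl) , y′∈ , refl =
  subst S (sym regroup)
    (IsSubmonoid.⊕-closed S-sub (translate-semigroup⊆submonoid s S-sub (gen ∘ there) y′∈) (gen (here refl) n))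
  where
  k = length L
  regroup : (ℕ.suc k ℕ· s) ⊕ (y′ ⊕ (n ℕ· l)) ≡ ((k ℕ· s) ⊕ y′) ⊕ (s ⊕ (n ℕ· l))
  regroup = trans (cong (_⊕ (y′ ⊕ (n ℕ· l))) (trans (ℕ·-suc k s) (⊕-comm s (k ℕ· s))))
                  (⊕-Properties.interchange (k ℕ· s) s y′ (n ℕ· l))

∈-removeAt⁻ : ∀ {a : T} (xs : List T) i → a ∈ removeAt xs i → a ∈ xs
∈-removeAt⁻ (x ∷ xs) zero    a∈         = there a∈
∈-removeAt⁻ (x ∷ xs) (suc i) (here a≡x) = here a≡x
∈-removeAt⁻ (x ∷ xs) (suc i) (there a∈) = there (∈-removeAt⁻ xs i a∈)

∈-removeAt : ∀ {a : T} (xs : List T) i → a ∈ xs → a ≡ lookup xs i ⊎ a ∈ removeAt xs i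
∈-removeAt (x ∷ xs) zero    (here a≡x) = inj₁ a≡x
∈-removeAt (x ∷ xs) zero    (there a∈) = inj₂ a∈
∈-removeAt (x ∷ xs) (suc i) (here a≡x) = inj₂ (here a≡x)
∈-removeAt (x ∷ xs) (suc i) (there a∈) = Sum.map₂ there (∈-removeAt xs i a∈)

module HilbertBasis {K : Subset d} (K-isSubmonoid : IsSubmonoid K) (pointed : Pointed K)
                    {B : List (Pt d)} (isHilbertBasis : IsHilbertBasis K B) where

  B⊆K : ∀ {b} → b ∈ B → K b
  B⊆K b∈ = proj₁ (proj₁ isHilbertBasis _ b∈)

  B⊆ℤ : ∀ {b} → b ∈ B → Integral b
  B⊆ℤ b∈ = proj₂ (proj₁ isHilbertBasis _ b∈)

  generates : K x → Integral x → Span IsNatural B x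
  generates Kx Ix = InSemigroup⇒Span (proj₁ (proj₂ isHilbertBasis) _ Kx Ix)

  semigroup⊆K : (∀ {l} → l ∈ L → K l) → Span IsNatural L x → K x
  semigroup⊆K = semigroup⊆submonoid K-isSubmonoid

  lookup∉removeAt : ∀ j → ¬ Span IsNatural (removeAt B j) (lookup B j)
  lookup∉removeAt j bⱼ∈ = proj₂ (proj₂ isHilbertBasis) j λ x Kx Ix →
    Span⇒InSemigroup (Semigroup.span-sub B⊆removeAt (generates Kx Ix))
    where
    B⊆removeAt : ∀ {l} → l ∈ B → Span IsNatural (removeAt B j) l
    B⊆removeAt l∈ with ∈-removeAt B j l∈
    ... | inj₁ refl = bⱼ∈
    ... | inj₂ l∈′  = Semigroup.span-∈ l∈′

  nonzero : ∀ {b} → b ∈ B → b ≢ 𝟘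
  nonzero b∈ refl = lookup∉removeAt (index b∈) (subst (Span IsNatural _) (lookup-index b∈) Semigroup.span-𝟘)

  module _ {b} (b∈ : b ∈ B) where
    private
      j = index b∈
      R = removeAt B j

      split : K x → Integral x → Span IsNatural (b ∷ R) x
      split Kx Ix = Semigroup.span-sub B⊆b∷R (generates Kx Ix)
        where
        B⊆b∷R : ∀ {l} → l ∈ B → Span IsNatural (b ∷ R) l
        B⊆b∷R l∈ with ∈-removeAt B j l∈
        ... | inj₁ refl = Semigroup.span-∈ (here (sym (lookup-index b∈)))
        ... | inj₂ l∈′  = Semigroup.span-∈ (there l∈′)

      -- A positive coefficient of b in u makes −v = u − b a point of K.
      absorbs : ∀ {u v y} n → Span IsNatural R y → K v → b ≡ u ⊕ v → u ≡ y ⊕ (ℕ.suc n ℕ· b) → v ≡ 𝟘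
      absorbs {u} {v} {y} n y∈ Kv b≡u⊕v u≡ =
        x⊕y≡𝟘⇒y≡𝟘 pointed Kw Kv (⊕-Properties.identityʳ-unique b (w ⊕ v) b⊕[w⊕v]≡b)
        where
        w = y ⊕ (n ℕ· b)
        Kw : K w
        Kw = IsSubmonoid.⊕-closed K-isSubmonoid (semigroup⊆K (B⊆K ∘ ∈-removeAt⁻ B j) y∈)
               (submonoid-ℕ· K-isSubmonoid (B⊆K b∈) n)
        b⊕[w⊕v]≡b : b ⊕ (w ⊕ v) ≡ b
        b⊕[w⊕v]≡b = begin
          b ⊕ (w ⊕ v)                 ≡⟨ ⊕-assoc b w v ⟨
          (b ⊕ (y ⊕ (n ℕ· b))) ⊕ v    ≡⟨ cong (_⊕ v) (⊕-Properties.x∙yz≈y∙xz b y (n ℕ· b)) ⟩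
          (y ⊕ (b ⊕ (n ℕ· b))) ⊕ v    ≡⟨ cong (λ t → (y ⊕ t) ⊕ v) (ℕ·-suc n b) ⟨
          (y ⊕ (ℕ.suc n ℕ· b)) ⊕ v    ≡⟨ cong (_⊕ v) u≡ ⟨
          u ⊕ v                       ≡⟨ b≡u⊕v ⟨
          b                           ∎
          where open ≡-Reasoning

    irreducible : ∀ {u v} → K u → Integral u → K v → Integral v → b ≡ u ⊕ v → u ≡ 𝟘 ⊎ v ≡ 𝟘
    irreducible {u} {v} Ku Iu Kv Iv b≡u⊕v = cases (span-∷⁻ (split Ku Iu)) (span-∷⁻ (split Kv Iv))
      where
      Split : Pt d → Set
      Split x = Σ ℚ λ c → Σ (Pt d) λ y → IsNatural c × Span IsNatural R y × x ≡ y ⊕ (c · b)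
      cases : Split u → Split v → u ≡ 𝟘 ⊎ v ≡ 𝟘
      cases (_ , y , (ℕ.suc m , refl) , y∈ , u≡) _ = inj₂ (absorbs m y∈ Kv b≡u⊕v u≡)
      cases (_ , _ , (ℕ.zero , refl) , _ , _) (_ , y′ , (ℕ.suc n , refl) , y′∈ , v≡) =
        inj₁ (absorbs n y′∈ Ku (trans b≡u⊕v (⊕-comm u v)) v≡)
      cases (_ , y , (ℕ.zero , refl) , y∈ , u≡) (_ , y′ , (ℕ.zero , refl) , y′∈ , v≡) =
        ⊥-elim (lookup∉removeAt j (subst (Span IsNatural R) b≡y⊕y′ (Semigroup.span-⊕ y∈ y′∈)))
        where
        drop0 : ∀ {x z} → x ≡ z ⊕ (0 ℕ· b) → x ≡ z
        drop0 {z = z} x≡ = trans x≡ (trans (cong (z ⊕_) (·-zeroˡ b)) (⊕-identityʳ z))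
        b≡y⊕y′ : y ⊕ y′ ≡ lookup B j
        b≡y⊕y′ = trans (sym (trans b≡u⊕v (cong₂ _⊕_ (drop0 u≡) (drop0 v≡)))) (lookup-index b∈)

  ∈semigroup⇒∈generators : ∀ {A : List (Pt d)} → (∀ {l} → l ∈ A → K l × Integral l × l ≢ 𝟘) →
                ∀ {b} → b ∈ B → Span IsNatural A b → b ∈ A
  ∈semigroup⇒∈generators {A = A} A-ok b∈ b∈Q =
    let r , l , r∈ , l∈ , b≡r⊕l = semigroup-decompose b∈Q (nonzero b∈)
        Kl , Il , l≢𝟘 = A-ok l∈
        Kr = semigroup⊆K (proj₁ ∘ A-ok) r∈
        Ir = lattice⊆integral (proj₁ ∘ proj₂ ∘ A-ok) (span-mono natural⇒integer r∈)
    in  [ (λ r≡𝟘 → subst (_∈ A) (sym (trans b≡r⊕l (trans (cong (_⊕ l) r≡𝟘) (⊕-identityˡ l)))) l∈)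
        , ⊥-elim ∘ l≢𝟘
        ]′ (irreducible b∈ Kr Ir Kl Il b≡r⊕l)

-- The generating set A

2ℚ : ℚ
2ℚ = + 2 / 1

½·2ℚ·x≡x : (x : Pt d) → ½ · (2ℚ · x) ≡ x
½·2ℚ·x≡x x = trans (sym (·-assoc ½ 2ℚ x)) (·-identityˡ x)

½·x⊕½·x≡x : (x : Pt d) → (½ · x) ⊕ (½ · x) ≡ x
½·x⊕½·x≡x x = trans (sym (·-distribʳ-+ ½ ½ x)) (·-identityˡ x)

2ℚ·x≡x⊕x : (x : Pt d) → 2ℚ · x ≡ x ⊕ x
2ℚ·x≡x⊕x x = trans (·-distribʳ-+ 1ℚ 1ℚ x) (cong₂ _⊕_ (·-identityˡ x) (·-identityˡ x))

module Construction (G : List (Pt d)) (pointed : Pointed (InCone G))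
                    {B : List (Pt d)} (isHilbertBasis : IsHilbertBasis (InCone G) B)
                    {M : ℕ} (i₀ : Fin M) (h : Fin M → Pt d)
                    (supporting : ∀ i → Supporting (InCone G) (h i)) where

  K : Subset d
  K = InCone G

  K-isSubmonoid : IsSubmonoid K
  K-isSubmonoid = record
    { 𝟘∈       = Span⇒InCone Cone.span-𝟘
    ; ⊕-closed = λ Kx Ky → Span⇒InCone (Cone.span-⊕ (InCone⇒Span Kx) (InCone⇒Span Ky))
    }

  K-· : ∀ {c} → 0ℚ ≤ c → K x → K (c · x)
  K-· 0≤c Kx = Span⇒InCone (Cone.span-· 0≤c (InCone⇒Span Kx))

  open HilbertBasis K-isSubmonoid pointed isHilbertBasis

  A : List (Pt d)
  A = genA B h

  b* : Fin M → Pt d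
  b* i = bStar B (h i)

  private
    ∈-B∩F⁻ : ∀ i {b} → b ∈ filter (h i ⟂?_) B → b ∈ B × h i ⟂ b
    ∈-B∩F⁻ i = ∈-filter⁻ (h i ⟂?_)

  b*∈K : ∀ i → K (b* i)
  b*∈K i = ∑-closed K-isSubmonoid (B⊆K ∘ proj₁ ∘ ∈-B∩F⁻ i)

  b*∈ℤ : ∀ i → Integral (b* i)
  b*∈ℤ i = ∑-closed integral-isSubmonoid (B⊆ℤ ∘ proj₁ ∘ ∈-B∩F⁻ i)

  h⟂b* : ∀ i → h i ⟂ b* i
  h⟂b* i = ∑-closed (⟂-isSubmonoid (h i)) (proj₂ ∘ ∈-B∩F⁻ i)

  private
    shifted : Fin M → Pt d → Pt d
    shifted i b = (2ℚ · b* i) ⊕ b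

  2·∈A : ∀ {b} → b ∈ B → 2ℚ · b ∈ A
  2·∈A b∈ = ∈-++⁺ˡ (∈-map⁺ (2ℚ ·_) b∈)

  2b*⊕∈A : ∀ i {b} → b ∈ 𝟘 ∷ B → (2ℚ · b* i) ⊕ b ∈ A
  2b*⊕∈A i b∈ = ∈-++⁺ʳ (List.map (2ℚ ·_) B)
    (∈-concatMap⁺ (λ j → List.map (shifted j) (𝟘 ∷ B)) (lose (∈-allFin i) (∈-map⁺ (shifted i) b∈)))

  ∈A⁻ : ∀ {l} → l ∈ A → (Σ (Pt d) λ b → b ∈ B × l ≡ 2ℚ · b) ⊎
                        (Σ (Fin M) λ i → Σ (Pt d) λ b → b ∈ 𝟘 ∷ B × l ≡ (2ℚ · b* i) ⊕ b)
  ∈A⁻ l∈ with ∈-++⁻ (List.map (2ℚ ·_) B) l∈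
  ... | inj₁ l∈₁ = inj₁ (∈-map⁻ (2ℚ ·_) l∈₁)
  ... | inj₂ l∈₂ =
    let i , _ , l∈₃ = find (∈-concatMap⁻ (λ j → List.map (shifted j) (𝟘 ∷ B)) {xs = allFin M} l∈₂)
    in  inj₂ (i , ∈-map⁻ (shifted i) l∈₃)

  𝟘∷B⊆K : ∀ {b} → b ∈ 𝟘 ∷ B → K b
  𝟘∷B⊆K (here refl) = IsSubmonoid.𝟘∈ K-isSubmonoid
  𝟘∷B⊆K (there b∈)  = B⊆K b∈

  𝟘∷B⊆ℤ : ∀ {b} → b ∈ 𝟘 ∷ B → Integral b
  𝟘∷B⊆ℤ (here refl) = IsSubmonoid.𝟘∈ integral-isSubmonoid
  𝟘∷B⊆ℤ (there b∈)  = B⊆ℤ b∈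

  A⊆K : ∀ {l} → l ∈ A → K l
  A⊆K l∈ with ∈A⁻ l∈
  ... | inj₁ (b , b∈ , refl)     = K-· (nonNegative⁻¹ 2ℚ) (B⊆K b∈)
  ... | inj₂ (i , b , b∈ , refl) =
    IsSubmonoid.⊕-closed K-isSubmonoid (K-· (nonNegative⁻¹ 2ℚ) (b*∈K i)) (𝟘∷B⊆K b∈)

  A⊆ℤ : ∀ {l} → l ∈ A → Integral l
  A⊆ℤ l∈ with ∈A⁻ l∈
  ... | inj₁ (b , b∈ , refl)     = integral-· {x = b} (+ 2 , refl) (B⊆ℤ b∈)
  ... | inj₂ (i , b , b∈ , refl) =
    IsSubmonoid.⊕-closed integral-isSubmonoid {2ℚ · b* i} {b}
      (integral-· {x = b* i} (+ 2 , refl) (b*∈ℤ i)) (𝟘∷B⊆ℤ b∈)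

  cone-A⊆K : InCone A x → K x
  cone-A⊆K = Span⇒InCone ∘ Cone.span-sub (InCone⇒Span ∘ A⊆K) ∘ InCone⇒Span

  K⊆cone-A : K x → InCone A x
  K⊆cone-A {x = x} Kx with clear-denominators x
  ... | c , c>0 , _ , Icx = Span⇒InCone (subst (Span (0ℚ ≤_) A) c⁻¹·c·x≡x (Cone.span-· c⁻¹≥0 c·x∈))
    where
    instance
      _ = pos⇒nonZero c {{c>0}}
    c⁻¹≥0 : 0ℚ ≤ 1/ c
    c⁻¹≥0 = <⇒≤ (positive⁻¹ (1/ c) {{1/pos⇒pos c {{c>0}}}})
    c⁻¹·c·x≡x : (1/ c) · (c · x) ≡ x
    c⁻¹·c·x≡x = trans (sym (·-assoc (1/ c) c x)) (trans (cong (_· x) (*-inverseˡ c)) (·-identityˡ x))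
    B⊆cone-A : ∀ {b} → b ∈ B → Span (0ℚ ≤_) A b
    B⊆cone-A {b} b∈ =
      subst (Span (0ℚ ≤_) A) (½·2ℚ·x≡x b) (Cone.span-· (nonNegative⁻¹ ½) (Cone.span-∈ (2·∈A b∈)))
    c·x∈ : Span (0ℚ ≤_) A (c · x)
    c·x∈ = Cone.span-sub B⊆cone-A (span-mono natural⇒nonNegative
             (generates (K-· (<⇒≤ (positive⁻¹ c {{c>0}})) Kx) Icx))

  lattice-A⊆ℤ : InLattice A x → Integral x
  lattice-A⊆ℤ = lattice⊆integral A⊆ℤ ∘ InLattice⇒Span

  K∩ℤ⊆lattice-A : K x → Integral x → InLattice A x
  K∩ℤ⊆lattice-A Kx Ix = Span⇒InLattice (Lattice.span-sub B⊆lattice-A (span-mono natural⇒integer (generates Kx Ix)))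
    where
    B⊆lattice-A : ∀ {b} → b ∈ B → Span IsInteger A b
    B⊆lattice-A {b} b∈ = subst (Span IsInteger A) difference
      (Lattice.span-⊕ (Lattice.span-∈ (2b*⊕∈A i₀ (there b∈)))
                      (Lattice.span-· -1-integer (Lattice.span-∈ (2b*⊕∈A i₀ (here refl)))))
      where
      s = 2ℚ · b* i₀
      difference : (s ⊕ b) ⊕ ((- 1ℚ) · (s ⊕ 𝟘)) ≡ b
      difference = begin
        (s ⊕ b) ⊕ ((- 1ℚ) · (s ⊕ 𝟘))   ≡⟨ cong ((s ⊕ b) ⊕_) (sym (⊝x≡-1·x (s ⊕ 𝟘))) ⟩
        (s ⊕ b) ⊕ (⊝ (s ⊕ 𝟘))          ≡⟨ cong (λ t → (s ⊕ b) ⊕ (⊝ t)) (⊕-identityʳ s) ⟩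
        (s ⊕ b) ⊕ (⊝ s)                ≡⟨ ⊕-Properties.xyx⁻¹≈y s b ⟩
        b                              ∎
        where open ≡-Reasoning

  Fᵢ-almostSaturated : ∀ i → AlmostSaturated K A (FaceOf K (h i))
  Fᵢ-almostSaturated i =
    a , (Ka , h⟂a) , Span⇒InSemigroup (subst (Span IsNatural A) (⊕-identityʳ a) (a⊕Q[B]⊆Q[A] Semigroup.span-𝟘)) ,
    λ y Ky Iy → Span⇒InSemigroup (a⊕Q[B]⊆Q[A] (generates Ky Iy))
    where
    s = 2ℚ · b* i
    a = length B ℕ· s
    multiples : ∀ {l} → l ∈ B → ∀ n → Span IsNatural A (s ⊕ (n ℕ· l))
    multiples {l} l∈ 0 =
      subst (Span IsNatural A) (cong (s ⊕_) (sym (·-zeroˡ l))) (Semigroup.span-∈ (2b*⊕∈A i (here refl)))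
    multiples {l} l∈ 1 =
      subst (Span IsNatural A) (cong (s ⊕_) (sym (·-identityˡ l))) (Semigroup.span-∈ (2b*⊕∈A i (there l∈)))
    multiples {l} l∈ (ℕ.suc (ℕ.suc n)) =
      subst (Span IsNatural A) (sym regroup) (Semigroup.span-⊕ (multiples l∈ n) (Semigroup.span-∈ (2·∈A l∈)))
      where
      regroup : s ⊕ ((2 ℕ.+ n) ℕ· l) ≡ (s ⊕ (n ℕ· l)) ⊕ (2 ℕ· l)
      regroup = trans (cong (s ⊕_) (ℕ·-+ 2 n l)) (⊕-Properties.x∙yz≈xz∙y s (2 ℕ· l) (n ℕ· l))
    a⊕Q[B]⊆Q[A] : Span IsNatural B y → Span IsNatural A (a ⊕ y)
    a⊕Q[B]⊆Q[A] = translate-semigroup⊆submonoid s Semigroup.span-isSubmonoid multiples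
    Ka : K a
    Ka = submonoid-ℕ· K-isSubmonoid (K-· (nonNegative⁻¹ 2ℚ) (b*∈K i)) (length B)
    h⟂a : h i ⟂ a
    h⟂a = ⟂-·⁺ (h i) (fromℤ (+ length B)) (⟂-·⁺ (h i) 2ℚ (h⟂b* i))

  ⟂b*⇒Fⱼ⊆face : ∀ g → Supporting K g → ∀ j → g ⟂ b* j → FaceOf K (h j) ⊆ FaceOf K g
  ⟂b*⇒Fⱼ⊆face g g-sup j g⟂b* x (Kx , hⱼ⟂x) with clear-denominators x
  ... | c , c>0 , _ , Icx = Kx , [ c≢0 , id ]′ (⟂-·⁻ g c g⟂c·x)
    where
    c≢0 : c ≡ 0ℚ → g ⟂ x
    c≢0 c≡0 = ⊥-elim (<-irrefl (sym c≡0) (positive⁻¹ c {{c>0}}))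
    B∩Fⱼ⊆g⟂ : ∀ {l} → l ∈ B → h j ⟂ l → g ⟂ l
    B∩Fⱼ⊆g⟂ l∈ hⱼ⟂l =
      ∑-⟂⁻ g (λ m → g-sup _ (B⊆K (proj₁ (∈-B∩F⁻ j m)))) g⟂b* (∈-filter⁺ (h j ⟂?_) l∈ hⱼ⟂l)
    g⟂c·x : g ⟂ (c · x)
    g⟂c·x = span-⟂-ind natural⇒nonNegative (h j) (λ l∈ → supporting j _ (B⊆K l∈)) (⟂-isSubmonoid g)
              (λ {e} _ l∈ hⱼ⟂l → ⟂-·⁺ g e (B∩Fⱼ⊆g⟂ l∈ hⱼ⟂l))
              (generates (K-· (<⇒≤ (positive⁻¹ c {{c>0}})) Kx) Icx) (⟂-·⁺ (h j) c hⱼ⟂x)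

  module _ {g} (g-sup : Supporting K g) (g⟂̸b* : ∀ j → ¬ g ⟂ b* j)
           {a} (g⟂a : g ⟂ a) (a∈ : Span IsNatural A a)
           (saturates : ∀ {y} → K y → Integral y → Span IsNatural A (a ⊕ y)) where
    private
      g⟂2ℚ·⁻ : g ⟂ (2ℚ · x) → g ⟂ x
      g⟂2ℚ·⁻ {x = x} g⟂2x = [ (λ ()) , id ]′ (⟂-·⁻ {x = x} g 2ℚ g⟂2x)

      A∩g⟂ : ∀ {l} → l ∈ A → g ⟂ l → Σ (Pt d) λ b → b ∈ B × g ⟂ b × l ≡ 2ℚ · b
      A∩g⟂ l∈ g⟂l with ∈A⁻ l∈
      ... | inj₁ (b , b∈ , refl)     = b , b∈ , g⟂2ℚ·⁻ g⟂l , refl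
      ... | inj₂ (i , b , b∈ , refl) =
        ⊥-elim (g⟂̸b* i (g⟂2ℚ·⁻ (proj₁
          (⟂-⊕⁻ g (g-sup _ (K-· (nonNegative⁻¹ 2ℚ) (b*∈K i))) (g-sup _ (𝟘∷B⊆K b∈)) g⟂l))))

      half-isSubmonoid : IsSubmonoid (λ z → Integral (½ · z))
      half-isSubmonoid = record
        { 𝟘∈       = subst Integral (sym (·-zeroʳ ½)) (IsSubmonoid.𝟘∈ (integral-isSubmonoid {d}))
        ; ⊕-closed = λ {x} {y} Ix Iy → subst Integral (sym (·-distribˡ-⊕ ½ x y))
                         (IsSubmonoid.⊕-closed integral-isSubmonoid {½ · x} {½ · y} Ix Iy)
        }

      Q[A]∩g⟂⊆½ℤ : Span IsNatural A x → g ⟂ x → Integral (½ · x)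
      Q[A]∩g⟂⊆½ℤ = span-⟂-ind natural⇒nonNegative g (λ l∈ → g-sup _ (A⊆K l∈)) half-isSubmonoid gen
        where
        gen : ∀ {c l} → IsNatural c → l ∈ A → g ⟂ l → Integral (½ · (c · l))
        gen (n , refl) l∈ g⟂l with A∩g⟂ l∈ g⟂l
        ... | b , b∈ , _ , refl =
          submonoid-ℕ· {x = 2ℚ · b} half-isSubmonoid (subst Integral (sym (½·2ℚ·x≡x b)) (B⊆ℤ b∈)) n

      B∩g⟂-empty : ∀ {y} → y ∈ B → ¬ g ⟂ y
      B∩g⟂-empty {y} y∈ g⟂y = [ u≢𝟘 , u≢𝟘 ]′ (irreducible y∈ Ku Iu Ku Iu (sym (½·x⊕½·x≡x y)))
        where
        u = ½ · y
        Ku : K u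
        Ku = K-· (nonNegative⁻¹ ½) (B⊆K y∈)
        half-difference : (½ · (a ⊕ y)) ⊖ (½ · a) ≡ u
        half-difference = trans (cong (_⊖ (½ · a)) (trans (·-distribˡ-⊕ ½ a y) (⊕-comm (½ · a) u)))
                                (x⊕y⊖y≡x u (½ · a))
        Iu : Integral u
        Iu = subst Integral half-difference (integral-⊖ {x = ½ · (a ⊕ y)}
               (Q[A]∩g⟂⊆½ℤ (saturates (B⊆K y∈) (B⊆ℤ y∈)) (IsSubmonoid.⊕-closed (⟂-isSubmonoid g) g⟂a g⟂y))
               (Q[A]∩g⟂⊆½ℤ a∈ g⟂a))
        u≢𝟘 : u ≢ 𝟘
        u≢𝟘 u≡𝟘 = nonzero y∈ (trans (sym (½·x⊕½·x≡x y)) (trans (cong₂ _⊕_ u≡𝟘 u≡𝟘) (⊕-identityʳ 𝟘)))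

      a≡𝟘 : a ≡ 𝟘
      a≡𝟘 = span-⟂-ind natural⇒nonNegative g (λ l∈ → g-sup _ (A⊆K l∈)) ≡𝟘-isSubmonoid excluded a∈ g⟂a
        where
        ≡𝟘-isSubmonoid : IsSubmonoid (_≡ 𝟘)
        ≡𝟘-isSubmonoid = record { 𝟘∈ = refl ; ⊕-closed = λ { refl refl → ⊕-identityʳ 𝟘 } }
        excluded : ∀ {c l} → IsNatural c → l ∈ A → g ⟂ l → c · l ≡ 𝟘
        excluded _ l∈ g⟂l = let b , b∈ , g⟂b , _ = A∩g⟂ l∈ g⟂l in ⊥-elim (B∩g⟂-empty b∈ g⟂b)

      B⊆A : ∀ {y} → y ∈ B → y ∈ A
      B⊆A {y} y∈ = ∈semigroup⇒∈generators A-admissible y∈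
        (subst (Span IsNatural A) (trans (cong (_⊕ y) a≡𝟘) (⊕-identityˡ y)) (saturates (B⊆K y∈) (B⊆ℤ y∈)))
        where
        A-admissible : ∀ {l} → l ∈ A → K l × Integral l × l ≢ 𝟘
        A-admissible l∈ = A⊆K l∈ , A⊆ℤ l∈ , λ l≡𝟘 →
          let b , b∈ , g⟂b , _ = A∩g⟂ l∈ (subst (g ⟂_) (sym l≡𝟘) (⟨,⟩-zeroʳ g)) in B∩g⟂-empty b∈ g⟂b

      b*≢𝟘 : ∀ j → b* j ≢ 𝟘
      b*≢𝟘 j b*≡𝟘 = g⟂̸b* j (subst (g ⟂_) (sym b*≡𝟘) (⟨,⟩-zeroʳ g))

    no-saturation-point : ⊥
    no-saturation-point with ∑≢𝟘⇒∃∈ (b*≢𝟘 i₀)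
    ... | y , y∈F = reducible (∈A⁻ (B⊆A y∈))
      where
      y∈ : y ∈ B
      y∈ = proj₁ (∈-B∩F⁻ i₀ y∈F)
      reducible : (Σ (Pt d) λ b → b ∈ B × y ≡ 2ℚ · b) ⊎
                  (Σ (Fin M) λ i → Σ (Pt d) λ b → b ∈ 𝟘 ∷ B × y ≡ (2ℚ · b* i) ⊕ b) → ⊥
      reducible (inj₁ (b , b∈ , y≡)) =
        [ nonzero b∈ , nonzero b∈ ]′
          (irreducible y∈ (B⊆K b∈) (B⊆ℤ b∈) (B⊆K b∈) (B⊆ℤ b∈) (trans y≡ (2ℚ·x≡x⊕x b)))
      reducible (inj₂ (j , b , b∈ , y≡)) =
        [ b*≢𝟘 j , b*≢𝟘 j ∘ b*⊕b≡𝟘⇒b*≡𝟘 ]′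
          (irreducible y∈ (b*∈K j) (b*∈ℤ j) Kb*⊕b Ib*⊕b (trans y≡ regroup))
        where
        Kb*⊕b : K (b* j ⊕ b)
        Kb*⊕b = IsSubmonoid.⊕-closed K-isSubmonoid (b*∈K j) (𝟘∷B⊆K b∈)
        Ib*⊕b : Integral (b* j ⊕ b)
        Ib*⊕b = IsSubmonoid.⊕-closed integral-isSubmonoid {b* j} {b} (b*∈ℤ j) (𝟘∷B⊆ℤ b∈)
        regroup : (2ℚ · b* j) ⊕ b ≡ b* j ⊕ (b* j ⊕ b)
        regroup = trans (cong (_⊕ b) (2ℚ·x≡x⊕x (b* j))) (⊕-assoc (b* j) (b* j) b)
        b*⊕b≡𝟘⇒b*≡𝟘 : b* j ⊕ b ≡ 𝟘 → b* j ≡ 𝟘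
        b*⊕b≡𝟘⇒b*≡𝟘 e = x⊕y≡𝟘⇒y≡𝟘 pointed (𝟘∷B⊆K b∈) (b*∈K j) (trans (⊕-comm b (b* j)) e)

  almostSaturated⇒⊇Fⱼ : ∀ {F} → IsFace K F → AlmostSaturated K A F → ∃ λ j → FaceOf K (h j) ⊆ F
  almostSaturated⇒⊇Fⱼ (g , g-sup , F⊆Fg , Fg⊆F) (a , Fa , a∈ , saturates) with Fin.any? (λ j → g ⟂? b* j)
  ... | yes (j , g⟂b*) = j , λ x x∈ → Fg⊆F x (⟂b*⇒Fⱼ⊆face g g-sup j g⟂b* x x∈)
  ... | no ∄j = ⊥-elim (no-saturation-point {g} g-sup (λ j g⟂b* → ∄j (j , g⟂b*)) {a} (proj₂ (F⊆Fg a Fa))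
                  (InSemigroup⇒Span a∈) (λ Ky Iy → InSemigroup⇒Span (saturates _ Ky Iy)))

-- Minimal almost saturated faces

minimalAlmostSaturated⇔ : ∀ {K : Subset d} {A M} (h : Fin M → Pt d) → (∀ i → Supporting K (h i)) →
  (∀ i → AlmostSaturated K A (FaceOf K (h i))) →
  (∀ {F} → IsFace K F → AlmostSaturated K A F → ∃ λ j → FaceOf K (h j) ⊆ F) →
  (∀ i j → i ≢ j → ¬ (FaceOf K (h i) ⊆ FaceOf K (h j))) →
  ∀ F → IsFace K F → (MinimalAlmostSaturated K A F ⇔ ∃ λ i → F ≐ FaceOf K (h i))
minimalAlmostSaturated⇔ {K = K} {A} h supporting Fᵢ-almostSaturated almostSaturated⇒⊇Fⱼ antichain
                        F F-face@(_ , _ , F⊆K∩g⟂ , _) = mk⇔ minimal⇒Fᵢ Fᵢ⇒minimal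
  where
  Fᵢ-face : ∀ i → IsFace K (FaceOf K (h i))
  Fᵢ-face i = h i , supporting i , (λ _ p → p) , (λ _ p → p)

  minimal⇒Fᵢ : MinimalAlmostSaturated K A F → ∃ λ i → F ≐ FaceOf K (h i)
  minimal⇒Fᵢ (F-saturated , minimal) with almostSaturated⇒⊇Fⱼ F-face F-saturated
  ... | j , Fⱼ⊆F = j , F⊆Fⱼ , Fⱼ⊆F
    where
    F⊆Fⱼ : F ⊆ FaceOf K (h j)
    F⊆Fⱼ x x∈F with h j ⟂? x
    ... | yes hⱼ⟂x = proj₁ (F⊆K∩g⟂ x x∈F) , hⱼ⟂x
    ... | no  hⱼ⟂̸x =
      ⊥-elim (minimal _ (Fᵢ-face j) Fⱼ⊆F (λ F⊆Fⱼ → hⱼ⟂̸x (proj₂ (F⊆Fⱼ x x∈F))) (Fᵢ-almostSaturated j))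

  Fᵢ⇒minimal : (∃ λ i → F ≐ FaceOf K (h i)) → MinimalAlmostSaturated K A F
  Fᵢ⇒minimal (i , F⊆Fᵢ , Fᵢ⊆F) = F-saturated , minimal
    where
    F-saturated : AlmostSaturated K A F
    F-saturated = let a , a∈Fᵢ , a-sat = Fᵢ-almostSaturated i in a , Fᵢ⊆F a a∈Fᵢ , a-sat
    minimal : ∀ G → IsFace K G → G ⊆ F → ¬ (F ⊆ G) → ¬ AlmostSaturated K A G
    minimal G G-face G⊆F F⊈G G-saturated with almostSaturated⇒⊇Fⱼ G-face G-saturated
    ... | j , Fⱼ⊆G with j Fin.≟ i
    ... | yes refl = F⊈G (λ x x∈F → Fⱼ⊆G x (F⊆Fᵢ x x∈F))
    ... | no  j≢i  = antichain j i j≢i (λ x x∈Fⱼ → F⊆Fᵢ x (G⊆F x (Fⱼ⊆G x x∈Fⱼ)))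

theorem4p1 : (d : ℕ) (G : List (Pt d)) →
    let K = InCone G in
    Pointed K → NonemptyInterior K →
    (B : List (Pt d)) → IsHilbertBasis K B →
    (M : ℕ) → M ≥ 1 → (h : Fin M → Pt d) → (∀ i → Supporting K (h i)) →
    (∀ i j → i ≢ j → ¬ (FaceOf K (h i) ⊆ FaceOf K (h j))) →
    let A = genA B h in
    (InCone A ≐ K) ×
    (∀ x → (InCone A x × InLattice A x) ⇔ (K x × Integral x)) ×
    (∀ F → IsFace K F →
      (MinimalAlmostSaturated K A F ⇔ ∃ λ i → F ≐ FaceOf K (h i)))
theorem4p1 d G pointed _ B isHilbertBasis (ℕ.suc M) _ h supporting antichain =
  ((λ _ → cone-A⊆K) , (λ _ → K⊆cone-A)) ,
  (λ x → mk⇔ (λ (x∈cone , x∈lattice) → cone-A⊆K x∈cone , lattice-A⊆ℤ x∈lattice)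
             (λ (Kx , Ix) → K⊆cone-A Kx , K∩ℤ⊆lattice-A Kx Ix)) ,
  minimalAlmostSaturated⇔ h supporting Fᵢ-almostSaturated almostSaturated⇒⊇Fⱼ antichain
  where open Construction G pointed isHilbertBasis zero h supporting
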